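{- Let $n\ge 2$ and $k$ be integers with $1\le k\le n-1$ and $n\neq 2k$, and let $P_n$ be the path graph on $\{1,\dots,n\}$ with edges $\{i,i+1\}$, $1\le i\le n-1$. Then every automorphism of the $k$-token graph $F_k(P_n)$ is induced by an automorphism of $P_n$; that is, for every $f\in\mathrm{Aut}(F_k(P_n))$ there is $\theta\in\mathrm{Aut}(P_n)$ with $f(\{a_1,\dots,a_k\})=\{\theta(a_1),\dots,\theta(a_k)\}$ for all vertices $\{a_1,\dots,a_k\}$. Equivalently, $\mathrm{Aut}(F_k(P_n))=\mathrm{Aut}(P_n)$ (so $|\mathrm{Aut}(F_k(P_n))|=2$).
   Context: All graphs are finite and simple. For a graph $\Gamma$ of order $n$ and an integer $1\le k\le n-1$, the $k$-token graph $F_k(\Gamma)$ has as vertices all $k$-element subsets of $V(\Gamma)$, two of them $A,B$ being adjacent iff their symmetric difference $A\triangle B$ is an edge of $\Gamma$. Each $\theta\in\mathrm{Aut}(\Gamma)$ induces the automorphism $A\mapsto\theta(A)$ of $F_k(\Gamma)$; writing $\mathrm{Aut}(F_k(\Gamma))=\mathrm{Aut}(\Gamma)$ means every automorphism of $F_k(\Gamma)$ arises this way. -}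

module Defs where

open import Data.Nat using (ℕ; suc)
open import Data.Bool using (Bool; _xor_)
open import Data.Fin using (Fin; toℕ)
open import Data.Fin.Subset using (Subset; ∣_∣; ⁅_⁆; _∪_)
open import Data.Vec using (zipWith; tabulate; lookup)
open import Data.Product using (Σ; ∃; ∃-syntax; _×_; proj₁)
open import Data.Sum using (_⊎_)
open import Relation.Binary.PropositionalEquality using (_≡_)
open import Function.Bundles using (_↔_; Inverse; _⇔_)

Graph : ℕ → Set₁
Graph n = Fin n → Fin n → Set

-- Path graph P_n on Fin n (vertex i ↔ i+1): edges {i, i+1}.
Path : (n : ℕ) → Graph n
Path n i j = (suc (toℕ i) ≡ toℕ j) ⊎ (suc (toℕ j) ≡ toℕ i)

_△_ : ∀ {n} → Subset n → Subset n → Subset n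
A △ B = zipWith _xor_ A B

Token : ℕ → ℕ → Set
Token n k = Σ (Subset n) (λ A → ∣ A ∣ ≡ k)

TokenAdj : ∀ {n} (Γ : Graph n) (k : ℕ) → Token n k → Token n k → Set
TokenAdj Γ k A B = ∃[ i ] ∃[ j ] (Γ i j × (proj₁ A △ proj₁ B ≡ ⁅ i ⁆ ∪ ⁅ j ⁆))

IsAut : ∀ {V : Set} (adj : V → V → Set) → V ↔ V → Set
IsAut adj f = ∀ x y → adj x y ⇔ adj (Inverse.to f x) (Inverse.to f y)

image : ∀ {n} → Fin n ↔ Fin n → Subset n → Subset n
image θ A = tabulate (λ y → lookup A (Inverse.from θ y))

-- Read a configuration of k tokens on P_n as a word in {0,1}ⁿ with k ones. Two configurations
-- are adjacent in F_k(P_n) exactly when one word arises from the other by replacing a factor 10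
-- with 01; such a step lowers the number of inversions by one, so F_k(P_n) is the cover graph of
-- a graded poset with bottom 0ⁿ⁻ᵏ1ᵏ. The bottom has a single neighbour, whereas a word with both
-- a lower and an upper cover has two, so an automorphism sends the bottom to the bottom or to the
-- top 1ᵏ0ⁿ⁻ᵏ; composing with the reflection of the path we may assume the former. It then
-- preserves rank and covers, and it fixes every word by induction on rank: a word with two lower
-- covers is their only common upper cover, and two distinct words with the same unique lower
-- cover are necessarily 0ᵖ1001 1ᵠ and 0ᵖ0110 1ᵠ. Exchanging these two would force exchanges along
-- two chains of unique upper covers, which can only terminate together when p = q, i.e. n = 2k.

module Submission where

open import Defs
open import Data.Bool using (Bool; true; false; _xor_)
open import Data.Bool.Properties using (xor-comm; xor-same; _≟_)
open import Data.Empty using (⊥-elim) renaming (⊥ to Empty)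
open import Data.List using (List; []; _∷_; _++_; length; replicate; reverse)
open import Data.List.Properties
  using (∷-injectiveˡ; ∷-injectiveʳ; length-++; length-replicate; reverse-++; unfold-reverse; reverse-involutive; ≡-dec)
open import Data.Nat using (ℕ; zero; suc; _+_; _∸_; _*_; _≤_; _<_; z≤n; s≤s)
open import Data.Nat.Properties using (suc-injective; +-suc; +-comm; +-cancelʳ-≡; ≡-irrelevant; <⇒≢; m<n+m; ≤-reflexive; ≤-trans; ≤-antisym; m≤n⇒m≤1+n; n≤1+n; +-identityʳ; +-∸-assoc; m∸n+n≡m; <⇒≤)
open import Data.Nat.Tactic.RingSolver using (solve-∀)
open import Data.Vec using (Vec; []; _∷_; _∷ʳ_; toList; fromList; lookup) renaming (reverse to reverseᵛ)
open import Data.Vec.Properties using (toList-injective; cast-is-id; zipWith-comm; tabulate-cong; tabulate∘lookup; toList∘fromList; length-toList)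
open import Data.Fin using (Fin; zero; suc; toℕ; opposite; fromℕ; inject₁)
open import Data.Fin.Properties using (opposite-prop; opposite-involutive; toℕ<n)
open import Data.Fin.Subset using (Subset; ∣_∣; ⊥; ⁅_⁆; _∪_)
open import Data.Fin.Subset.Properties using (∪-idem; ∪-comm)
import Data.Vec.Properties as V
open import Data.Product using (Σ; ∃; ∃₂; ∃-syntax; _×_; _,_; proj₁)
open import Data.Sum using (_⊎_; inj₁; inj₂)
import Data.Sum as Sum
open import Function using (_∘_; case_of_)
open import Function.Bundles using (_↔_; _⇔_; Inverse; Equivalence; mk⇔; mk↔ₛ′)
open import Function.Construct.Composition using (_↔-∘_; _⇔-∘_)
open import Function.Construct.Symmetry using (↔-sym; ⇔-sym)
open import Function.Construct.Identity using (↔-id; ⇔-id)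
open import Relation.Nullary using (¬_; yes; no)
open import Relation.Binary.PropositionalEquality

m≢2+m : ∀ m → m ≢ 2 + m
m≢2+m m = <⇒≢ (m<n+m m (s≤s z≤n))

replicate-++-∷ : ∀ {A : Set} m (x : A) xs → replicate m x ++ x ∷ xs ≡ x ∷ replicate m x ++ xs
replicate-++-∷ zero x xs = refl
replicate-++-∷ (suc m) x xs = cong (x ∷_) (replicate-++-∷ m x xs)

module _ {V : Set} {adj : V → V → Set} where

  IsAut-⇔ : {adj′ : V → V → Set} → (∀ x y → adj x y ⇔ adj′ x y) → (f : V ↔ V) → IsAut adj f → IsAut adj′ f
  IsAut-⇔ adj⇔adj′ f f-aut x y = adj⇔adj′ _ _ ⇔-∘ (f-aut x y ⇔-∘ ⇔-sym (adj⇔adj′ x y))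

  IsAut-∘ : (f g : V ↔ V) → IsAut adj f → IsAut adj g → IsAut adj (g ↔-∘ f)
  IsAut-∘ f g f-aut g-aut x y = g-aut _ _ ⇔-∘ f-aut x y

  IsAut-sym : (f : V ↔ V) → IsAut adj f → IsAut adj (↔-sym f)
  IsAut-sym f f-aut x y = mk⇔
    (λ a → Equivalence.from (f-aut (from x) (from y)) (subst₂ adj (sym (inverseˡ x)) (sym (inverseˡ y)) a))
    (λ a → subst₂ adj (inverseˡ x) (inverseˡ y) (Equivalence.to (f-aut (from x) (from y)) a))
    where open Inverse f using (from) renaming (strictlyInverseˡ to inverseˡ)

0^ 1^ : ℕ → List Bool
0^ m = replicate m false
1^ m = replicate m true

∣_∣₀ ∣_∣₁ inversions : List Bool → ℕ
∣ [] ∣₀ = 0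
∣ true ∷ s ∣₀ = ∣ s ∣₀
∣ false ∷ s ∣₀ = suc ∣ s ∣₀
∣ [] ∣₁ = 0
∣ true ∷ s ∣₁ = suc ∣ s ∣₁
∣ false ∷ s ∣₁ = ∣ s ∣₁
inversions [] = 0
inversions (true ∷ s) = ∣ s ∣₀ + inversions s
inversions (false ∷ s) = inversions s

infix 4 _↘_ _↘!_ _~_

data _↘_ : List Bool → List Bool → Set where
  here  : ∀ {s} → true ∷ false ∷ s ↘ false ∷ true ∷ s
  there : ∀ {x s t} → s ↘ t → x ∷ s ↘ x ∷ t

_~_ : List Bool → List Bool → Set
s ~ t = s ↘ t ⊎ t ↘ s

_↘!_ : List Bool → List Bool → Set
s ↘! t = s ↘ t × (∀ {t′} → s ↘ t′ → t′ ≡ t)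

↘-length : ∀ {s t} → s ↘ t → length s ≡ length t
↘-length here = refl
↘-length (there p) = cong suc (↘-length p)

↘-∣∣₁ : ∀ {s t} → s ↘ t → ∣ s ∣₁ ≡ ∣ t ∣₁
↘-∣∣₁ here = refl
↘-∣∣₁ (there {true} p) = cong suc (↘-∣∣₁ p)
↘-∣∣₁ (there {false} p) = ↘-∣∣₁ p

↘-∣∣₀ : ∀ {s t} → s ↘ t → ∣ s ∣₀ ≡ ∣ t ∣₀
↘-∣∣₀ here = refl
↘-∣∣₀ (there {true} p) = ↘-∣∣₀ p
↘-∣∣₀ (there {false} p) = cong suc (↘-∣∣₀ p)

↘-inversions : ∀ {s t} → s ↘ t → inversions s ≡ suc (inversions t)
↘-inversions here = refl
↘-inversions (there {false} p) = ↘-inversions p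
↘-inversions (there {true} {t = t} p) =
  trans (cong₂ _+_ (↘-∣∣₀ p) (↘-inversions p)) (+-suc ∣ t ∣₀ (inversions t))

↘-++ˡ : ∀ w {s t} → s ↘ t → w ++ s ↘ w ++ t
↘-++ˡ [] p = p
↘-++ˡ (x ∷ w) p = there (↘-++ˡ w p)

↘-++ʳ : ∀ w {s t} → s ↘ t → s ++ w ↘ t ++ w
↘-++ʳ w here = here
↘-++ʳ w (there p) = there (↘-++ʳ w p)

↘-reverse : ∀ {s t} → s ↘ t → reverse t ↘ reverse s
↘-reverse (here {s}) = subst₂ _↘_
  (sym (reverse-++ (false ∷ true ∷ []) s)) (sym (reverse-++ (true ∷ false ∷ []) s))
  (↘-++ˡ (reverse s) here)
↘-reverse (there {x} {s} {t} p) = subst₂ _↘_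
  (sym (unfold-reverse x t)) (sym (unfold-reverse x s)) (↘-++ʳ (x ∷ []) (↘-reverse p))

∣∣₁-++ : ∀ s t → ∣ s ++ t ∣₁ ≡ ∣ s ∣₁ + ∣ t ∣₁
∣∣₁-++ [] t = refl
∣∣₁-++ (true ∷ s) t = cong suc (∣∣₁-++ s t)
∣∣₁-++ (false ∷ s) t = ∣∣₁-++ s t

∣∣₁-reverse : ∀ s → ∣ reverse s ∣₁ ≡ ∣ s ∣₁
∣∣₁-reverse [] = refl
∣∣₁-reverse (x ∷ s) = begin
  ∣ reverse (x ∷ s) ∣₁         ≡⟨ cong ∣_∣₁ (unfold-reverse x s) ⟩
  ∣ reverse s ++ x ∷ [] ∣₁     ≡⟨ ∣∣₁-++ (reverse s) (x ∷ []) ⟩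
  ∣ reverse s ∣₁ + ∣ x ∷ [] ∣₁ ≡⟨ cong (_+ ∣ x ∷ [] ∣₁) (∣∣₁-reverse s) ⟩
  ∣ s ∣₁ + ∣ x ∷ [] ∣₁         ≡⟨ +-comm ∣ s ∣₁ _ ⟩
  ∣ x ∷ [] ∣₁ + ∣ s ∣₁         ≡⟨ ∣∣₁-++ (x ∷ []) s ⟨
  ∣ x ∷ s ∣₁                   ∎
  where open ≡-Reasoning

Sorted : List Bool → Set
Sorted s = ∃₂ λ a b → s ≡ 0^ a ++ 1^ b

1^-irreducible : ∀ b {t} → ¬ (1^ b ↘ t)
1^-irreducible (suc zero) (there ())
1^-irreducible (suc (suc b)) (there p) = 1^-irreducible (suc b) p

sorted-irreducible : ∀ a b {t} → ¬ (0^ a ++ 1^ b ↘ t)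
sorted-irreducible zero b = 1^-irreducible b
sorted-irreducible (suc a) b (there p) = sorted-irreducible a b p

step-or-sorted : ∀ s → ∃ (s ↘_) ⊎ Sorted s
step-or-sorted [] = inj₂ (0 , 0 , refl)
step-or-sorted (x ∷ s) with step-or-sorted s
step-or-sorted (x ∷ s)     | inj₁ (t , p)           = inj₁ (x ∷ t , there p)
step-or-sorted (false ∷ s) | inj₂ (a , b , refl)     = inj₂ (suc a , b , refl)
step-or-sorted (true ∷ s)  | inj₂ (zero , b , refl)  = inj₂ (0 , suc b , refl)
step-or-sorted (true ∷ s)  | inj₂ (suc a , b , refl) = inj₁ (_ , here)

∣1^∣₀ : ∀ b → ∣ 1^ b ∣₀ ≡ 0
∣1^∣₀ zero = refl
∣1^∣₀ (suc b) = ∣1^∣₀ b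

inversions-sorted : ∀ a b → inversions (0^ a ++ 1^ b) ≡ 0
inversions-sorted (suc a) b = inversions-sorted a b
inversions-sorted zero zero = refl
inversions-sorted zero (suc b) = cong₂ _+_ (∣1^∣₀ b) (inversions-sorted zero b)

inversions≡0⇒sorted : ∀ s → inversions s ≡ 0 → Sorted s
inversions≡0⇒sorted s inv≡0 with step-or-sorted s
... | inj₂ sorted = sorted
... | inj₁ (_ , p) with () ← trans (sym inv≡0) (↘-inversions p)

∣0^-++∣₁ : ∀ a s → ∣ 0^ a ++ s ∣₁ ≡ ∣ s ∣₁
∣0^-++∣₁ zero s = refl
∣0^-++∣₁ (suc a) s = ∣0^-++∣₁ a s

∣1^∣₁ : ∀ b → ∣ 1^ b ∣₁ ≡ b
∣1^∣₁ zero = refl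
∣1^∣₁ (suc b) = cong suc (∣1^∣₁ b)

∣sorted∣₁ : ∀ a b → ∣ 0^ a ++ 1^ b ∣₁ ≡ b
∣sorted∣₁ a b = trans (∣0^-++∣₁ a (1^ b)) (∣1^∣₁ b)

length-sorted : ∀ a b → length (0^ a ++ 1^ b) ≡ a + b
length-sorted a b = trans (length-++ (0^ a)) (cong₂ _+_ (length-replicate a) (length-replicate b))

sorted-unique : ∀ {s t} → Sorted s → Sorted t → length s ≡ length t → ∣ s ∣₁ ≡ ∣ t ∣₁ → s ≡ t
sorted-unique (a , b , refl) (a′ , b′ , refl) len ones
  with refl ← trans (sym (∣sorted∣₁ a b)) (trans ones (∣sorted∣₁ a′ b′))
  with refl ← +-cancelʳ-≡ b a a′ (trans (sym (length-sorted a b)) (trans len (length-sorted a′ b)))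
  = refl

no-step-into-1^ : ∀ b {t} → ¬ (t ↘ 1^ b)
no-step-into-1^ (suc b) (there p) = no-step-into-1^ b p

sorted-upper-cover-unique : ∀ a b {t t′} → t ↘ 0^ a ++ 1^ b → t′ ↘ 0^ a ++ 1^ b → t ≡ t′
sorted-upper-cover-unique zero b p _ = ⊥-elim (no-step-into-1^ b p)
sorted-upper-cover-unique (suc zero) zero (there ()) _
sorted-upper-cover-unique (suc zero) (suc b) here here = refl
sorted-upper-cover-unique (suc zero) (suc b) here (there q) = ⊥-elim (no-step-into-1^ (suc b) q)
sorted-upper-cover-unique (suc zero) (suc b) (there p) _ = ⊥-elim (no-step-into-1^ (suc b) p)
sorted-upper-cover-unique (suc (suc a)) b (there p) (there q) =
  cong (false ∷_) (sorted-upper-cover-unique (suc a) b p q)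

common-lower-covers⇒≡ : ∀ {s t u u′} → s ↘ u → s ↘ u′ → t ↘ u → t ↘ u′ → u ≢ u′ → s ≡ t
common-lower-covers⇒≡ (there p) (there p′) (there q) (there q′) u≢u′ =
  cong (_ ∷_) (common-lower-covers⇒≡ p p′ q q′ (u≢u′ ∘ cong (_ ∷_)))
common-lower-covers⇒≡ here here _ _ u≢u′ = ⊥-elim (u≢u′ refl)
common-lower-covers⇒≡ here (there _) here _ _ = refl
common-lower-covers⇒≡ here (there (there _)) (there (there _)) () _
common-lower-covers⇒≡ (there _) here _ here _ = refl
common-lower-covers⇒≡ (there _) (there _) here here u≢u′ = ⊥-elim (u≢u′ refl)

unique-or-another : ∀ {s t} → s ↘ t → s ↘! t ⊎ ∃ λ t′ → s ↘ t′ × t′ ≢ t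
unique-or-another (here {s}) with step-or-sorted s
... | inj₁ (t , p) = inj₂ (_ , there (there p) , λ ())
... | inj₂ (a , b , refl) =
  inj₁ (here , λ { here → refl ; (there (there p)) → ⊥-elim (sorted-irreducible a b p) })
unique-or-another (there {true} {false ∷ s} p) = inj₂ (_ , here , λ ())
unique-or-another (there {true} {true ∷ s} p) with unique-or-another p
... | inj₁ (_ , unique) = inj₁ (there p , λ { (there q) → cong (true ∷_) (unique q) })
... | inj₂ (t′ , q , t′≢t) = inj₂ (true ∷ t′ , there q , t′≢t ∘ ∷-injectiveʳ)
unique-or-another (there {false} p) with unique-or-another p
... | inj₁ (_ , unique) = inj₁ (there p , λ { (there q) → cong (false ∷_) (unique q) })
... | inj₂ (t′ , q , t′≢t) = inj₂ (false ∷ t′ , there q , t′≢t ∘ ∷-injectiveʳ)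

blocks : ℕ → ℕ → ℕ → ℕ → List Bool
blocks a b c d = 0^ a ++ 1^ b ++ 0^ c ++ 1^ d

X Y : ℕ → ℕ → List Bool
X p q = blocks p 1 2 (suc q)
Y p q = blocks (suc p) 2 1 q

Exceptional : List Bool → List Bool → Set
Exceptional s t = ∃₂ λ p q → s ≡ X p q × t ≡ Y p q

↘!-∷⁻ : ∀ {x s u} → x ∷ s ↘! x ∷ u → s ↘! u
↘!-∷⁻ (there p , unique) = p , ∷-injectiveʳ ∘ unique ∘ there

private
  exceptional-head : ∀ {s t} → t ↘ true ∷ s →
    true ∷ false ∷ s ↘! false ∷ true ∷ s → false ∷ t ↘! false ∷ true ∷ s →
    Exceptional (true ∷ false ∷ s) (false ∷ t)
  exceptional-head {s} p (_ , s-unique) (_ , t-unique) with step-or-sorted s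
  ... | inj₁ (_ , q) with () ← s-unique (there (there q))
  exceptional-head (there {s = false ∷ _} _) _ (_ , t-unique) | inj₂ _ with () ← t-unique (there here)
  exceptional-head (there {s = true ∷ _} p) _ _ | inj₂ (zero , b , refl) = ⊥-elim (no-step-into-1^ b p)
  exceptional-head (there {s = true ∷ _} ()) _ _ | inj₂ (suc zero , zero , refl)
  exceptional-head (there {s = true ∷ _} here) _ _ | inj₂ (suc zero , suc b , refl) = 0 , b , refl , refl
  exceptional-head (there {s = true ∷ _} ()) _ _ | inj₂ (suc (suc a) , b , refl)

  exceptional-not-under-1 : ∀ {s t u} → Exceptional s t → true ∷ s ↘! true ∷ u → ¬ (true ∷ t ↘! true ∷ u)
  exceptional-not-under-1 (suc p , q , refl , refl) (_ , s-unique) _ with () ← s-unique here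
  exceptional-not-under-1 (zero , q , refl , refl) _ (_ , t-unique) with () ← t-unique here

  false∷-exceptional : ∀ {s t} → Exceptional s t → Exceptional (false ∷ s) (false ∷ t)
  false∷-exceptional (p , q , refl , refl) = suc p , q , refl , refl

unique-lower-cover⇒exceptional : ∀ {s t u} → s ↘! u → t ↘! u → s ≢ t → Exceptional s t ⊎ Exceptional t s
unique-lower-cover⇒exceptional (here , _) (here , _) s≢t = ⊥-elim (s≢t refl)
unique-lower-cover⇒exceptional s↘!u@(here , _) t↘!u@(there q , _) _ = inj₁ (exceptional-head q s↘!u t↘!u)
unique-lower-cover⇒exceptional s↘!u@(there p , _) t↘!u@(here , _) _ = inj₂ (exceptional-head p t↘!u s↘!u)
unique-lower-cover⇒exceptional {false ∷ _} s↘!u@(there _ , _) t↘!u@(there _ , _) s≢t =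
  Sum.map false∷-exceptional false∷-exceptional
    (unique-lower-cover⇒exceptional (↘!-∷⁻ s↘!u) (↘!-∷⁻ t↘!u) (s≢t ∘ cong (false ∷_)))
unique-lower-cover⇒exceptional {true ∷ _} s↘!u@(there _ , _) t↘!u@(there _ , _) s≢t =
  ⊥-elim (Sum.[ (λ e → exceptional-not-under-1 e s↘!u t↘!u) , (λ e → exceptional-not-under-1 e t↘!u s↘!u) ]
    (unique-lower-cover⇒exceptional (↘!-∷⁻ s↘!u) (↘!-∷⁻ t↘!u) (s≢t ∘ cong (true ∷_))))

shared-unique-lower-cover : ∀ {s t u} → s ↘! u → t ↘! u → s ≡ t ⊎ Exceptional s t ⊎ Exceptional t s
shared-unique-lower-cover {s} {t} s↘!u t↘!u with ≡-dec _≟_ s t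
... | yes s≡t = inj₁ s≡t
... | no s≢t = inj₂ (unique-lower-cover⇒exceptional s↘!u t↘!u s≢t)

blocks-lower-cover : ∀ a b c d → blocks a (suc b) (suc c) d ↘! 0^ a ++ 1^ b ++ false ∷ true ∷ 0^ c ++ 1^ d
blocks-lower-cover (suc a) b c d with blocks-lower-cover a b c d
... | p , unique = there p , λ { (there q) → cong (false ∷_) (unique q) }
blocks-lower-cover zero zero c d =
  here , λ { here → refl ; (there q) → ⊥-elim (sorted-irreducible (suc c) d q) }
blocks-lower-cover zero (suc b) c d with blocks-lower-cover zero b c d
... | p , unique = there p , λ { (there q) → cong (true ∷_) (unique q) }

0^-++-injectiveʳ : ∀ p p′ {s s′} → 0^ p ++ true ∷ s ≡ 0^ p′ ++ true ∷ s′ → s ≡ s′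
0^-++-injectiveʳ zero zero eq = ∷-injectiveʳ eq
0^-++-injectiveʳ (suc p) (suc p′) eq = 0^-++-injectiveʳ p p′ (∷-injectiveʳ eq)
0^-++-injectiveʳ zero (suc _) ()
0^-++-injectiveʳ (suc _) zero ()

length-X : ∀ p q → length (X p q) ≡ p + (4 + q)
length-X p q = trans (length-++ (0^ p)) (cong₂ _+_ (length-replicate p) (cong (4 +_) (length-replicate q)))

∣X∣₁ : ∀ p q → ∣ X p q ∣₁ ≡ 2 + q
∣X∣₁ p q = trans (∣0^-++∣₁ p _) (cong (2 +_) (∣1^∣₁ q))

X≢blocks : ∀ {p q} a b c d → X p q ≢ blocks a (suc (suc b)) c d
X≢blocks {p} a _ _ _ eq with () ← ∷-injectiveˡ (0^-++-injectiveʳ p a eq)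

Y≢blocks : ∀ {p q} a b c d → Y p q ≢ blocks a (suc (suc (suc b))) c d
Y≢blocks {p} a _ _ _ eq with () ← ∷-injectiveˡ (∷-injectiveʳ (0^-++-injectiveʳ (suc p) a eq))

¬↘!-100 : ∀ {t s} → ¬ (t ↘! true ∷ false ∷ false ∷ s)
¬↘!-100 (there (there _) , unique) with () ← unique here

no-step-into-1^0 : ∀ c {t} → ¬ (t ↘ 1^ c ++ false ∷ [])
no-step-into-1^0 zero (there ())
no-step-into-1^0 (suc c) (there p) = no-step-into-1^0 c p

¬↘!-0ᵐ1ᶜ0 : ∀ m c {t} → ¬ (t ↘! blocks m (suc (suc c)) 1 0)
¬↘!-0ᵐ1ᶜ0 zero c (there p , _) = no-step-into-1^0 (suc c) p
¬↘!-0ᵐ1ᶜ0 (suc zero) c (here , unique) = case unique final-step of λ ()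
  where
  final-step : true ∷ false ∷ true ∷ 1^ c ++ false ∷ [] ↘ true ∷ false ∷ 1^ c ++ false ∷ true ∷ []
  final-step = subst (λ s → true ∷ false ∷ s ↘ true ∷ false ∷ 1^ c ++ false ∷ true ∷ []) (replicate-++-∷ c true (false ∷ []))
    (↘-++ˡ (true ∷ false ∷ 1^ c) here)
¬↘!-0ᵐ1ᶜ0 (suc m) c t↘!@(there _ , _) = ¬↘!-0ᵐ1ᶜ0 m c (↘!-∷⁻ t↘!)

private
  variable
    n k : ℕ

str : Token n k → List Bool
str = toList ∘ proj₁

rank : Token n k → ℕ
rank = inversions ∘ str

infix 4 _~ᵗ_

_~ᵗ_ : Token n k → Token n k → Set
u ~ᵗ v = str u ~ str v

∣∣≡∣toList∣₁ : (A : Subset n) → ∣ A ∣ ≡ ∣ toList A ∣₁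
∣∣≡∣toList∣₁ [] = refl
∣∣≡∣toList∣₁ (true ∷ A) = cong suc (∣∣≡∣toList∣₁ A)
∣∣≡∣toList∣₁ (false ∷ A) = ∣∣≡∣toList∣₁ A

str-length : (v : Token n k) → length (str v) ≡ n
str-length = length-toList ∘ proj₁

str-∣∣₁ : (v : Token n k) → ∣ str v ∣₁ ≡ k
str-∣∣₁ (A , ∣A∣≡k) = trans (sym (∣∣≡∣toList∣₁ A)) ∣A∣≡k

toList-injective′ : (A B : Subset n) → toList A ≡ toList B → A ≡ B
toList-injective′ A B eq = trans (sym (cast-is-id refl A)) (toList-injective refl A B eq)

str-injective : {u v : Token n k} → str u ≡ str v → u ≡ v
str-injective {u = A , p} {v = B , q} eq with refl ← toList-injective′ A B eq = cong (A ,_) (≡-irrelevant p q)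

token : (s : List Bool) → length s ≡ n → ∣ s ∣₁ ≡ k → Σ (Token n k) λ v → str v ≡ s
token s refl refl = (fromList s , trans (∣∣≡∣toList∣₁ (fromList s)) (cong ∣_∣₁ (toList∘fromList s))) , toList∘fromList s

token-below : (v : Token n k) {t : List Bool} → str v ↘ t → Σ (Token n k) λ w → str w ≡ t
token-below v p = token _ (trans (sym (↘-length p)) (str-length v)) (trans (sym (↘-∣∣₁ p)) (str-∣∣₁ v))

token-above : (v : Token n k) {t : List Bool} → t ↘ str v → Σ (Token n k) λ w → str w ≡ t
token-above v p = token _ (trans (↘-length p) (str-length v)) (trans (↘-∣∣₁ p) (str-∣∣₁ v))

rank≡0-unique : {u v : Token n k} → rank u ≡ 0 → rank v ≡ 0 → u ≡ v
rank≡0-unique {u = u} {v} ru rv = str-injective (sorted-unique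
  (inversions≡0⇒sorted (str u) ru) (inversions≡0⇒sorted (str v) rv)
  (trans (str-length u) (sym (str-length v))) (trans (str-∣∣₁ u) (sym (str-∣∣₁ v))))

△-comm : (A B : Subset n) → A △ B ≡ B △ A
△-comm = zipWith-comm xor-comm

△-self : (A : Subset n) → A △ A ≡ ⊥
△-self [] = refl
△-self (a ∷ A) = cong₂ _∷_ (xor-same a) (△-self A)

xor≡false⇒≡ : ∀ a b → a xor b ≡ false → a ≡ b
xor≡false⇒≡ true true _ = refl
xor≡false⇒≡ false false _ = refl

△≡⊥⇒≡ : (A B : Subset n) → A △ B ≡ ⊥ → A ≡ B
△≡⊥⇒≡ [] [] _ = refl
△≡⊥⇒≡ (a ∷ A) (b ∷ B) eq =
  cong₂ _∷_ (xor≡false⇒≡ a b (V.∷-injectiveˡ eq)) (△≡⊥⇒≡ A B (V.∷-injectiveʳ eq))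

Edge : Subset n → Subset n → Set
Edge {n} A B = ∃₂ λ (i j : Fin n) → suc (toℕ i) ≡ toℕ j × A △ B ≡ ⁅ i ⁆ ∪ ⁅ j ⁆

↘⇒Edge : ∀ {s t} → s ↘ t → (A B : Subset n) → toList A ≡ s → toList B ≡ t → Edge A B
↘⇒Edge here (true ∷ false ∷ A) (false ∷ true ∷ B) refl eq
  with refl ← toList-injective′ B A (∷-injectiveʳ (∷-injectiveʳ eq)) =
  zero , suc zero , refl , cong (λ C → true ∷ true ∷ C) (trans (△-self A) (sym (∪-idem ⊥)))
↘⇒Edge (there p) (a ∷ A) (b ∷ B) refl eq with refl ← ∷-injectiveˡ eq
  with i , j , i+1≡j , A△B ← ↘⇒Edge p A B refl (∷-injectiveʳ eq) =
  suc i , suc j , cong suc i+1≡j , cong₂ _∷_ (xor-same a) A△B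

Edge⇒~ : (A B : Subset n) → Edge A B → ∣ A ∣ ≡ ∣ B ∣ → toList A ~ toList B
Edge⇒~ (a₀ ∷ a₁ ∷ A) (b₀ ∷ b₁ ∷ B) (zero , suc zero , _ , eq) ∣A∣≡∣B∣
  with refl ← △≡⊥⇒≡ A B (trans (V.∷-injectiveʳ (V.∷-injectiveʳ eq)) (∪-idem ⊥))
  = flip-pair a₀ a₁ b₀ b₁ (V.∷-injectiveˡ eq) (V.∷-injectiveˡ (V.∷-injectiveʳ eq)) ∣A∣≡∣B∣
  where
  flip-pair : ∀ a₀ a₁ b₀ b₁ → a₀ xor b₀ ≡ true → a₁ xor b₁ ≡ true → ∣ a₀ ∷ a₁ ∷ A ∣ ≡ ∣ b₀ ∷ b₁ ∷ A ∣ →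
    toList (a₀ ∷ a₁ ∷ A) ~ toList (b₀ ∷ b₁ ∷ A)
  flip-pair true false false true _ _ _ = inj₁ here
  flip-pair false true true false _ _ _ = inj₂ here
  flip-pair true true false false _ _ eq = ⊥-elim (m≢2+m _ (sym eq))
  flip-pair false false true true _ _ eq = ⊥-elim (m≢2+m _ eq)
Edge⇒~ (a ∷ A) (b ∷ B) (suc i , suc j , i+1≡j , eq) ∣a∷A∣≡∣b∷B∣
  with refl ← xor≡false⇒≡ a b (V.∷-injectiveˡ eq) =
  Sum.map there there (Edge⇒~ A B (i , j , suc-injective i+1≡j , V.∷-injectiveʳ eq) (∣∣-tail a ∣a∷A∣≡∣b∷B∣))
  where
  ∣∣-tail : ∀ a → ∣ a ∷ A ∣ ≡ ∣ a ∷ B ∣ → ∣ A ∣ ≡ ∣ B ∣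
  ∣∣-tail true = suc-injective
  ∣∣-tail false eq = eq
Edge⇒~ _ _ (zero , zero , () , _) _
Edge⇒~ _ _ (zero , suc (suc _) , () , _) _
Edge⇒~ _ _ (suc _ , zero , () , _) _

TokenAdj⇔~ᵗ : (u v : Token n k) → TokenAdj (Path n) k u v ⇔ u ~ᵗ v
TokenAdj⇔~ᵗ (A , ∣A∣≡k) (B , ∣B∣≡k) = mk⇔ to from
  where
  ∣A∣≡∣B∣ : ∣ A ∣ ≡ ∣ B ∣
  ∣A∣≡∣B∣ = trans ∣A∣≡k (sym ∣B∣≡k)
  to : TokenAdj (Path _) _ (A , ∣A∣≡k) (B , ∣B∣≡k) → toList A ~ toList B
  to (i , j , inj₁ i+1≡j , eq) = Edge⇒~ A B (i , j , i+1≡j , eq) ∣A∣≡∣B∣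
  to (i , j , inj₂ j+1≡i , eq) = Edge⇒~ A B (j , i , j+1≡i , trans eq (∪-comm ⁅ i ⁆ ⁅ j ⁆)) ∣A∣≡∣B∣
  from : toList A ~ toList B → TokenAdj (Path _) _ (A , ∣A∣≡k) (B , ∣B∣≡k)
  from (inj₁ p) with i , j , i+1≡j , eq ← ↘⇒Edge p A B refl refl = i , j , inj₁ i+1≡j , eq
  from (inj₂ p) with i , j , i+1≡j , eq ← ↘⇒Edge p B A refl refl = i , j , inj₁ i+1≡j , trans (△-comm A B) eq

~⇒inversions≤ : ∀ {s t} → s ~ t → inversions s ≤ suc (inversions t)
~⇒inversions≤ (inj₁ p) = ≤-reflexive (↘-inversions p)
~⇒inversions≤ {s} (inj₂ p) = subst (λ r → inversions s ≤ suc r) (sym (↘-inversions p)) (m≤n⇒m≤1+n (n≤1+n _))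

~⇒↘ : ∀ {s t} → s ~ t → inversions s ≡ suc (inversions t) → s ↘ t
~⇒↘ (inj₁ p) _ = p
~⇒↘ (inj₂ p) eq = ⊥-elim (m≢2+m _ (trans (↘-inversions p) (cong suc eq)))

lower-cover-of-rank-suc : (v : Token n k) {r : ℕ} → rank v ≡ suc r → ∃ λ w → str v ↘ str w × rank w ≡ r
lower-cover-of-rank-suc v rv with step-or-sorted (str v)
... | inj₂ (a , b , eq) with () ← trans (sym rv) (trans (cong inversions eq) (inversions-sorted a b))
... | inj₁ (_ , p) with w , refl ← token-below v p = w , p , suc-injective (trans (sym (↘-inversions p)) rv)

token-above! : (u : Token n k) {s t : List Bool} → str u ≡ s → t ↘! s → Σ (Token n k) λ w → str w ≡ t × str w ↘! str u
token-above! u refl t↘!s with w , refl ← token-above u (proj₁ t↘!s) = w , refl , t↘!s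

rank-≤ : (ψ : Token n k → Token n k) → (∀ {u v} → u ~ᵗ v → ψ u ~ᵗ ψ v) → (∀ v → rank v ≡ 0 → ψ v ≡ v) →
         ∀ v → rank (ψ v) ≤ rank v
rank-≤ ψ ψ-~ ψ-fixes v = go (rank v) v refl
  where
  go : ∀ r v → rank v ≡ r → rank (ψ v) ≤ r
  go zero v rv = ≤-reflexive (trans (cong rank (ψ-fixes v rv)) rv)
  go (suc r) v rv with w , p , rw ← lower-cover-of-rank-suc v rv =
    ≤-trans (~⇒inversions≤ (ψ-~ (inj₁ p))) (s≤s (go r w rw))

↘-preserved : (ψ : Token n k → Token n k) → (∀ {u v} → u ~ᵗ v → ψ u ~ᵗ ψ v) → (∀ v → rank (ψ v) ≡ rank v) →
              ∀ {u v} → str u ↘ str v → str (ψ u) ↘ str (ψ v)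
↘-preserved ψ ψ-~ ψ-rank {u} {v} p =
  ~⇒↘ (ψ-~ (inj₁ p)) (trans (ψ-rank u) (trans (↘-inversions p) (cong suc (sym (ψ-rank v)))))

↘!-preserved : (ψ ψ⁻¹ : Token n k → Token n k) → (∀ v → ψ (ψ⁻¹ v) ≡ v) → (∀ v → ψ⁻¹ (ψ v) ≡ v) →
               (∀ {u v} → str u ↘ str v → str (ψ u) ↘ str (ψ v)) →
               (∀ {u v} → str u ↘ str v → str (ψ⁻¹ u) ↘ str (ψ⁻¹ v)) →
               ∀ {u v} → str u ↘! str v → str (ψ u) ↘! str (ψ v)
↘!-preserved ψ ψ⁻¹ ψψ⁻¹ ψ⁻¹ψ ψ-↘ ψ⁻¹-↘ {u} {v} (p , unique) = ψ-↘ p , λ q → lower q (token-below (ψ u) q)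
  where
  lower : ∀ {t} → str (ψ u) ↘ t → Σ (Token _ _) (λ w → str w ≡ t) → t ≡ str (ψ v)
  lower q (w , refl) = cong str (begin
    w           ≡⟨ ψψ⁻¹ w ⟨
    ψ (ψ⁻¹ w)   ≡⟨ cong ψ (str-injective (unique (subst (λ x → str x ↘ str (ψ⁻¹ w)) (ψ⁻¹ψ u) (ψ⁻¹-↘ q)))) ⟩
    ψ v         ∎)
    where open ≡-Reasoning

m+[4+m]≡2*[2+m] : ∀ m → m + (4 + m) ≡ 2 * (2 + m)
m+[4+m]≡2*[2+m] = solve-∀

module GradedAutomorphism (φ : Token n k ↔ Token n k) (φ-aut : IsAut _~ᵗ_ φ)
                          (φ-rank0 : ∀ v → rank v ≡ 0 → rank (Inverse.to φ v) ≡ 0) where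

  open Inverse φ using (to; from; strictlyInverseˡ; strictlyInverseʳ)

  to-~ : ∀ {u v} → u ~ᵗ v → to u ~ᵗ to v
  to-~ = Equivalence.to (φ-aut _ _)

  from-~ : ∀ {u v} → u ~ᵗ v → from u ~ᵗ from v
  from-~ = Equivalence.to (IsAut-sym φ φ-aut _ _)

  to-fixes-rank0 : ∀ v → rank v ≡ 0 → to v ≡ v
  to-fixes-rank0 v rv = rank≡0-unique (φ-rank0 v rv) rv

  from-fixes-rank0 : ∀ v → rank v ≡ 0 → from v ≡ v
  from-fixes-rank0 v rv = trans (cong from (sym (to-fixes-rank0 v rv))) (strictlyInverseʳ v)

  from-rank0 : ∀ v → rank v ≡ 0 → rank (from v) ≡ 0
  from-rank0 v rv = trans (cong rank (from-fixes-rank0 v rv)) rv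

  to-rank : ∀ v → rank (to v) ≡ rank v
  to-rank v = ≤-antisym (rank-≤ to to-~ to-fixes-rank0 v)
    (subst (λ w → rank w ≤ rank (to v)) (strictlyInverseʳ v) (rank-≤ from from-~ from-fixes-rank0 (to v)))

  from-rank : ∀ v → rank (from v) ≡ rank v
  from-rank v = trans (sym (to-rank (from v))) (cong rank (strictlyInverseˡ v))

  to-↘ : ∀ {u v} → str u ↘ str v → str (to u) ↘ str (to v)
  to-↘ = ↘-preserved to to-~ to-rank

  from-↘ : ∀ {u v} → str u ↘ str v → str (from u) ↘ str (from v)
  from-↘ = ↘-preserved from from-~ from-rank

  to-↘! : ∀ {u v} → str u ↘! str v → str (to u) ↘! str (to v)
  to-↘! = ↘!-preserved to from strictlyInverseˡ strictlyInverseʳ to-↘ from-↘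

  from-↘! : ∀ {u v} → str u ↘! str v → str (from u) ↘! str (from v)
  from-↘! = ↘!-preserved from to strictlyInverseʳ strictlyInverseˡ from-↘ to-↘

  module _ (n≢2k : n ≢ 2 * k) {p q : ℕ} (x : Token n k) (x≡X : str x ≡ X p q) where

    private
      L Z : ℕ → ℕ → List Bool
      L a b = blocks a 1 b (suc q)
      Z c d = blocks (suc p) c 1 d

      L-lower-cover : ∀ a b → L a (suc b) ↘! L (suc a) b
      L-lower-cover a b = subst (L a (suc b) ↘!_) (replicate-++-∷ a false _) (blocks-lower-cover a 0 b (suc q))

      p≢q : p ≢ q
      p≢q refl = n≢2k (begin
        n              ≡⟨ str-length x ⟨
        length (str x) ≡⟨ cong length x≡X ⟩
        length (X p p) ≡⟨ length-X p p ⟩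
        p + (4 + p)    ≡⟨ m+[4+m]≡2*[2+m] p ⟩
        2 * (2 + p)    ≡⟨ cong (2 *_) (∣X∣₁ p p) ⟨
        2 * ∣ X p p ∣₁  ≡⟨ cong (λ s → 2 * ∣ s ∣₁) x≡X ⟨
        2 * ∣ str x ∣₁  ≡⟨ cong (2 *_) (str-∣∣₁ x) ⟩
        2 * k          ∎)
        where open ≡-Reasoning

      -- u′ and w′ below are the unique upper covers of u and of to u: the lone one of L moves
      -- left and the first block of ones of Z grows, until one of the chains gets stuck.
      climb : ∀ a c d → a + c ≡ p → c + d ≡ q → (u : Token n k) → str u ≡ L a (2 + c) → str (to u) ≢ Z (2 + c) d
      climb zero c zero c≡p c+0≡q _ _ _ = p≢q (trans (sym c≡p) (trans (sym (+-identityʳ c)) c+0≡q))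
      climb (suc a) c zero _ _ u u≡L tu≡Z
        with u′ , _ , u′↘!u ← token-above! u u≡L (L-lower-cover a (2 + c))
        = ¬↘!-0ᵐ1ᶜ0 (suc p) c (subst (str (to u′) ↘!_) tu≡Z (to-↘! u′↘!u))
      climb zero c (suc d) _ _ u u≡L tu≡Z
        with w′ , _ , w′↘!tu ← token-above! (to u) tu≡Z (blocks-lower-cover (suc p) (2 + c) 0 d)
        = ¬↘!-100 (subst (str (from w′) ↘!_) (trans (cong str (strictlyInverseʳ u)) u≡L) (from-↘! w′↘!tu))
      climb (suc a) c (suc d) a+c≡p c+d≡q u u≡L tu≡Z
        with u′ , u′≡L , u′↘!u ← token-above! u u≡L (L-lower-cover a (2 + c))
           | w′ , w′≡Z , w′↘!tu ← token-above! (to u) tu≡Z (blocks-lower-cover (suc p) (2 + c) 0 d)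
        with shared-unique-lower-cover (to-↘! u′↘!u) w′↘!tu
      ... | inj₁ tu′≡w′ = climb a (suc c) d (trans (+-suc a c) a+c≡p) (trans (sym (+-suc c d)) c+d≡q) u′ u′≡L (trans tu′≡w′ w′≡Z)
      ... | inj₂ (inj₁ (_ , _ , _ , w′≡Y)) = Y≢blocks (suc p) c 1 d (trans (sym w′≡Y) w′≡Z)
      ... | inj₂ (inj₂ (_ , _ , w′≡X , _)) = X≢blocks (suc p) (suc c) 1 d (trans (sym w′≡X) w′≡Z)

    X↦Y-impossible : str (to x) ≢ Y p q
    X↦Y-impossible = climb p 0 q (+-identityʳ p) refl x x≡X

rigidity : n ≢ 2 * k → (φ : Token n k ↔ Token n k) → IsAut _~ᵗ_ φ →
           (∀ v → rank v ≡ 0 → rank (Inverse.to φ v) ≡ 0) → ∀ v → Inverse.to φ v ≡ v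
rigidity n≢2k φ φ-aut φ-rank0 v = fix (rank v) v refl
  where
  open Inverse φ using (to; strictlyInverseʳ)
  module G = GradedAutomorphism φ φ-aut φ-rank0
  module G⁻¹ = GradedAutomorphism (↔-sym φ) (IsAut-sym φ φ-aut) G.from-rank0

  fix : ∀ r v → rank v ≡ r → to v ≡ v
  fix zero v rv = G.to-fixes-rank0 v rv
  fix (suc r) v rv with w , v↘w , rw ← lower-cover-of-rank-suc v rv = fix-above (unique-or-another v↘w)
    where
    fixed-cover : ∀ w → str v ↘ str w → str (to v) ↘ str w
    fixed-cover w v↘w = subst (λ x → str (to v) ↘ str x)
      (fix r w (suc-injective (trans (sym (↘-inversions v↘w)) rv))) (G.to-↘ v↘w)

    fix-above : str v ↘! str w ⊎ ∃ (λ t′ → str v ↘ t′ × t′ ≢ str w) → to v ≡ v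
    fix-above (inj₂ (_ , v↘t′ , t′≢w)) with w′ , refl ← token-below v v↘t′ =
      str-injective (sym (common-lower-covers⇒≡ v↘w v↘t′ (fixed-cover w v↘w) (fixed-cover w′ v↘t′) (t′≢w ∘ sym)))
    fix-above (inj₁ v↘!w)
      with shared-unique-lower-cover v↘!w
             (subst (λ x → str (to v) ↘! str x) (fix r w rw) (G.to-↘! v↘!w))
    ... | inj₁ v≡tv = str-injective (sym v≡tv)
    ... | inj₂ (inj₁ (_ , _ , v≡X , tv≡Y)) = ⊥-elim (G.X↦Y-impossible n≢2k v v≡X tv≡Y)
    ... | inj₂ (inj₂ (_ , _ , tv≡X , v≡Y)) =
      ⊥-elim (G⁻¹.X↦Y-impossible n≢2k (to v) tv≡X (trans (cong str (strictlyInverseʳ v)) v≡Y))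

lookup-∷ʳ-fromℕ : ∀ {A : Set} {m} (xs : Vec A m) x → lookup (xs ∷ʳ x) (fromℕ m) ≡ x
lookup-∷ʳ-fromℕ [] x = refl
lookup-∷ʳ-fromℕ (_ ∷ xs) x = lookup-∷ʳ-fromℕ xs x

lookup-∷ʳ-inject₁ : ∀ {A : Set} {m} (xs : Vec A m) x i → lookup (xs ∷ʳ x) (inject₁ i) ≡ lookup xs i
lookup-∷ʳ-inject₁ (_ ∷ xs) x zero = refl
lookup-∷ʳ-inject₁ (_ ∷ xs) x (suc i) = lookup-∷ʳ-inject₁ xs x i

lookup-reverse : ∀ {A : Set} (xs : Vec A n) (i : Fin n) → lookup (reverseᵛ xs) (opposite i) ≡ lookup xs i
lookup-reverse {suc n} (x ∷ xs) zero =
  trans (cong (λ ys → lookup ys (fromℕ n)) (V.reverse-∷ x xs)) (lookup-∷ʳ-fromℕ (reverseᵛ xs) x)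
lookup-reverse {suc n} (x ∷ xs) (suc i) =
  trans (cong (λ ys → lookup ys (inject₁ (opposite i))) (V.reverse-∷ x xs))
    (trans (lookup-∷ʳ-inject₁ (reverseᵛ xs) x (opposite i)) (lookup-reverse xs i))

opposite↔ : Fin n ↔ Fin n
opposite↔ = mk↔ₛ′ opposite opposite opposite-involutive opposite-involutive

toList-image-opposite : (A : Subset n) → toList (image opposite↔ A) ≡ reverse (toList A)
toList-image-opposite A = trans (cong toList image≡reverse) (V.toList-reverse A)
  where
  image≡reverse : image opposite↔ A ≡ reverseᵛ A
  image≡reverse = trans
    (tabulate-cong λ i → trans (sym (lookup-reverse A (opposite i))) (cong (lookup (reverseᵛ A)) (opposite-involutive i)))
    (tabulate∘lookup (reverseᵛ A))

opposite-IsAut : IsAut (Path n) opposite↔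
opposite-IsAut {n} i j = mk⇔ flip (subst₂ (Path n) (opposite-involutive i) (opposite-involutive j) ∘ flip)
  where
  opposite-edge : ∀ (i j : Fin n) → suc (toℕ i) ≡ toℕ j → suc (toℕ (opposite j)) ≡ toℕ (opposite i)
  opposite-edge i j i+1≡j rewrite opposite-prop i | opposite-prop j =
    trans (sym (+-∸-assoc 1 (toℕ<n j))) (cong (n ∸_) (sym i+1≡j))
  flip : ∀ {i j} → Path n i j → Path n (opposite i) (opposite j)
  flip {i} {j} (inj₁ i+1≡j) = inj₂ (opposite-edge i j i+1≡j)
  flip {i} {j} (inj₂ j+1≡i) = inj₁ (opposite-edge j i j+1≡i)

reflectᵗ : Token n k → Token n k
reflectᵗ (A , ∣A∣≡k) = image opposite↔ A , (begin
  ∣ image opposite↔ A ∣              ≡⟨ ∣∣≡∣toList∣₁ (image opposite↔ A) ⟩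
  ∣ toList (image opposite↔ A) ∣₁    ≡⟨ cong ∣_∣₁ (toList-image-opposite A) ⟩
  ∣ reverse (toList A) ∣₁            ≡⟨ ∣∣₁-reverse (toList A) ⟩
  ∣ toList A ∣₁                      ≡⟨ ∣∣≡∣toList∣₁ A ⟨
  ∣ A ∣                              ≡⟨ ∣A∣≡k ⟩
  _                                  ∎)
  where open ≡-Reasoning

str-reflectᵗ : (v : Token n k) → str (reflectᵗ v) ≡ reverse (str v)
str-reflectᵗ (A , _) = toList-image-opposite A

reflectᵗ-involutive : (v : Token n k) → reflectᵗ (reflectᵗ v) ≡ v
reflectᵗ-involutive v = str-injective (begin
  str (reflectᵗ (reflectᵗ v)) ≡⟨ str-reflectᵗ (reflectᵗ v) ⟩
  reverse (str (reflectᵗ v))  ≡⟨ cong reverse (str-reflectᵗ v) ⟩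
  reverse (reverse (str v))   ≡⟨ reverse-involutive (str v) ⟩
  str v                       ∎)
  where open ≡-Reasoning

reflect : Token n k ↔ Token n k
reflect = mk↔ₛ′ reflectᵗ reflectᵗ reflectᵗ-involutive reflectᵗ-involutive

~-reverse : ∀ {s t} → s ~ t → reverse s ~ reverse t
~-reverse (inj₁ p) = inj₂ (↘-reverse p)
~-reverse (inj₂ p) = inj₁ (↘-reverse p)

reflect-IsAut : IsAut _~ᵗ_ (reflect {n} {k})
reflect-IsAut u v = mk⇔ to (λ a → subst₂ _~_ (reverse-involutive (str u)) (reverse-involutive (str v)) (~-reverse (from′ a)))
  where
  to : u ~ᵗ v → reflectᵗ u ~ᵗ reflectᵗ v
  to a = subst₂ _~_ (sym (str-reflectᵗ u)) (sym (str-reflectᵗ v)) (~-reverse a)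
  from′ : reflectᵗ u ~ᵗ reflectᵗ v → reverse (str u) ~ reverse (str v)
  from′ = subst₂ _~_ (str-reflectᵗ u) (str-reflectᵗ v)

rank0-token : k ≤ n → Σ (Token n k) λ m → rank m ≡ 0
rank0-token {k} {n} k≤n
  with m , m≡sorted ← token (0^ (n ∸ k) ++ 1^ k) (trans (length-sorted (n ∸ k) k) (m∸n+n≡m k≤n)) (∣sorted∣₁ (n ∸ k) k)
  = m , trans (cong inversions m≡sorted) (inversions-sorted (n ∸ k) k)

rank0-neighbour-unique : {m u v : Token n k} → rank m ≡ 0 → m ~ᵗ u → m ~ᵗ v → u ≡ v
rank0-neighbour-unique {m = m} {u} {v} rm m~u m~v with a , b , m≡sorted ← inversions≡0⇒sorted (str m) rm =
  str-injective (sorted-upper-cover-unique a b (upper u m~u) (upper v m~v))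
  where
  upper : ∀ u → m ~ᵗ u → str u ↘ 0^ a ++ 1^ b
  upper _ (inj₁ p) = ⊥-elim (sorted-irreducible a b (subst (_↘ _) m≡sorted p))
  upper _ (inj₂ p) = subst (_ ↘_) m≡sorted p

upper-cover-or-reverse-sorted : ∀ s → ∃ (_↘ s) ⊎ Sorted (reverse s)
upper-cover-or-reverse-sorted s with step-or-sorted (reverse s)
... | inj₁ (t , p) = inj₁ (reverse t , subst (reverse t ↘_) (reverse-involutive s) (↘-reverse p))
... | inj₂ sorted = inj₂ sorted

rank0-image : (φ : Token n k ↔ Token n k) → IsAut _~ᵗ_ φ → ∀ m → rank m ≡ 0 →
              rank (Inverse.to φ m) ≡ 0 ⊎ rank (reflectᵗ (Inverse.to φ m)) ≡ 0
rank0-image φ φ-aut m rm = extreme (step-or-sorted (str (to m))) (upper-cover-or-reverse-sorted (str (to m)))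
  where
  open Inverse φ using (to; from; strictlyInverseˡ; strictlyInverseʳ)

  m~from : ∀ w → to m ~ᵗ w → m ~ᵗ from w
  m~from w a = subst (_~ᵗ from w) (strictlyInverseʳ m) (Equivalence.to (IsAut-sym φ φ-aut (to m) w) a)

  not-interior : ∀ w₁ w₂ → str (to m) ↘ str w₁ → str w₂ ↘ str (to m) → Empty
  not-interior w₁ w₂ p₁ p₂ =
    m≢2+m (rank w₂) (trans (↘-inversions p₂) (cong suc (trans (↘-inversions p₁) (cong (suc ∘ rank) w₁≡w₂))))
    where
    open ≡-Reasoning
    w₁≡w₂ : w₁ ≡ w₂
    w₁≡w₂ = begin
      w₁             ≡⟨ strictlyInverseˡ w₁ ⟨
      to (from w₁)   ≡⟨ cong to (rank0-neighbour-unique {m = m} rm (m~from w₁ (inj₁ p₁)) (m~from w₂ (inj₂ p₂))) ⟩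
      to (from w₂)   ≡⟨ strictlyInverseˡ w₂ ⟩
      w₂             ∎

  extreme : ∃ (str (to m) ↘_) ⊎ Sorted (str (to m)) → ∃ (_↘ str (to m)) ⊎ Sorted (reverse (str (to m))) →
            rank (to m) ≡ 0 ⊎ rank (reflectᵗ (to m)) ≡ 0
  extreme (inj₂ (a , b , eq)) _ = inj₁ (trans (cong inversions eq) (inversions-sorted a b))
  extreme _ (inj₂ (a , b , eq)) = inj₂ (trans (cong inversions (trans (str-reflectᵗ (to m)) eq)) (inversions-sorted a b))
  extreme (inj₁ (_ , p₁)) (inj₁ (_ , p₂))
    with w₁ , refl ← token-below (to m) p₁ | w₂ , refl ← token-above (to m) p₂ = ⊥-elim (not-interior w₁ w₂ p₁ p₂)

rank0-everywhere : (ψ : Token n k → Token n k) {m : Token n k} → rank m ≡ 0 → rank (ψ m) ≡ 0 →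
                   ∀ v → rank v ≡ 0 → rank (ψ v) ≡ 0
rank0-everywhere ψ rm ψm-rank0 v rv = subst (λ x → rank (ψ x) ≡ 0) (rank≡0-unique rm rv) ψm-rank0

automorphism-classification : n ≢ 2 * k → k ≤ n → (φ : Token n k ↔ Token n k) → IsAut _~ᵗ_ φ →
  (∀ v → Inverse.to φ v ≡ v) ⊎ (∀ v → Inverse.to φ v ≡ reflectᵗ v)
automorphism-classification n≢2k k≤n φ φ-aut with m , rm ← rank0-token k≤n | rank0-image φ φ-aut m rm
... | inj₁ φm-rank0 = inj₁ (rigidity n≢2k φ φ-aut (rank0-everywhere (Inverse.to φ) rm φm-rank0))
... | inj₂ rφm-rank0 = inj₂ λ v → begin
  to v                       ≡⟨ reflectᵗ-involutive (to v) ⟨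
  reflectᵗ (reflectᵗ (to v)) ≡⟨ cong reflectᵗ (reflect∘φ-fixed v) ⟩
  reflectᵗ v                 ∎
  where
  open Inverse φ using (to)
  open ≡-Reasoning
  reflect∘φ-fixed : ∀ v → reflectᵗ (to v) ≡ v
  reflect∘φ-fixed = rigidity n≢2k (reflect ↔-∘ φ) (IsAut-∘ φ reflect φ-aut reflect-IsAut)
    (rank0-everywhere (reflectᵗ ∘ to) rm rφm-rank0)

theorem2 : (n k : ℕ) → 2 ≤ n → 1 ≤ k → k < n → n ≢ 2 * k →
    (f : Token n k ↔ Token n k) → IsAut (TokenAdj (Path n) k) f →
    ∃[ θ ] (IsAut (Path n) θ ×
      (∀ (A : Token n k) → proj₁ (Inverse.to f A) ≡ image θ (proj₁ A)))
theorem2 n k _ _ k<n n≢2k f f-aut with automorphism-classification n≢2k (<⇒≤ k<n) f (IsAut-⇔ TokenAdj⇔~ᵗ f f-aut)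
... | inj₁ f≗id = ↔-id (Fin n) , (λ _ _ → ⇔-id _) , λ A → trans (cong proj₁ (f≗id A)) (sym (tabulate∘lookup (proj₁ A)))
... | inj₂ f≗reflect = opposite↔ , opposite-IsAut , λ A → cong proj₁ (f≗reflect A)
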